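{- Let $t$ be a $\bar{\mathsf{sh}}$-normalizable term and $t_0$ its $\bar{\mathsf{sh}}$-normal form. For every reduction sequence $d \colon t \to_{\bar{\mathsf{sh}}}^* t_0$, every type derivation $\pi$ of $t$ with $|\pi| = \min\{|\pi'| \mid \pi' \text{ a derivation of } t\}$ and every type derivation $\pi_0$ of $t_0$ with $|\pi_0| = \min\{|\pi_0'| \mid \pi_0' \text{ a derivation of } t_0\}$, one has $\mathrm{leng}_{\beta_v}(d) = |\pi| - \|t_0\| = |\pi| - |\pi_0|$. If moreover $t_0$ is a value, then $\mathrm{leng}_{\beta_v}(d) = |\pi|$.
   Context: Terms: $t ::= x \mid \lambda x.t \mid tu$ up to $\alpha$-conversion; values are variables and abstractions. Balanced contexts: $B ::= [\cdot] \mid (\lambda x.B)t \mid Bt \mid tB$. Root rules: $(\lambda x.t)v \mapsto_{\beta_v} t\{v/x\}$ ($v$ value); $(\lambda x.t)us \mapsto_{\sigma_1} (\lambda x.ts)u$ if $x\notin\mathrm{fv}(s)$; $v((\lambda x.s)u) \mapsto_{\sigma_3} (\lambda x.vs)u$ if $v$ value and $x \notin \mathrm{fv}(v)$. $\to_{\bar{\beta}_v}$, $\to_{\bar\sigma}$ are the closures of $\mapsto_{\beta_v}$ and of $\mapsto_{\sigma_1}\cup\mapsto_{\sigma_3}$ under balanced contexts, and $\to_{\bar{\mathsf{sh}}} = \to_{\bar\beta_v}\cup\to_{\bar\sigma}$. For a reduction sequence $d$ of $\to_{\bar{\mathsf{sh}}}$, $\mathrm{leng}_{\beta_v}(d)$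 is the number of $\bar\beta_v$-steps in $d$. Types: negative $N ::= P\multimap Q$; positive $P,Q ::= [N_1,\dots,N_n]$ finite multisets ($n\ge0$), $\mathbf{0}$ the empty multiset. Environments: maps from variables to positive types, $\mathbf{0}$ almost everywhere; $\uplus$ pointwise multiset sum. Rules: (ax) $x\colon P\vdash x\colon P$; (@) from $\Gamma\vdash t\colon[P\multimap Q]$ and $\Gamma'\vdash u\colon P$ infer $\Gamma\uplus\Gamma'\vdash tu\colon Q$; ($\lambda$) for $n\ge0$, from $\Gamma_i,x\colon P_i\vdash t\colon Q_i$ ($1\le i\le n$) infer $\biguplus_i\Gamma_i\vdash\lambda x.t\colon[P_1\multimap Q_1,\dots,P_n\multimap Q_n]$. A derivation of $t$ is any derivation with conclusion $\Gamma\vdash t\colon P$ for some $\Gamma,P$. The size $|\pi|$ is the number of (@) rules in $\pi$. Balanced size: $\|v\| = 0$ for $v$ a value; $\|tu\| = \|s\|+\|u\|+1$ if $t = \lambda x.s$, and $\|tu\| = \|t\|+\|u\|+1$ otherwise. -}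

module Defs where

open import Data.Nat using (ℕ; zero; suc; _+_; _≤_; _≡ᵇ_)
open import Data.Bool using (if_then_else_)
open import Data.List using (List; []; _∷_; _++_)
open import Data.Product using (Σ; _×_; _,_)
open import Relation.Nullary using (¬_)

-- Terms (de Bruijn indices: terms up to α-conversion)

data Tm : Set where
  var : ℕ → Tm
  lam : Tm → Tm
  app : Tm → Tm → Tm

data Value : Tm → Set where
  var : (x : ℕ) → Value (var x)
  lam : (t : Tm) → Value (lam t)

ext : (ℕ → ℕ) → ℕ → ℕ
ext ρ zero    = zero
ext ρ (suc n) = suc (ρ n)

rename : (ℕ → ℕ) → Tm → Tm
rename ρ (var x)   = var (ρ x)
rename ρ (lam t)   = lam (rename (ext ρ) t)
rename ρ (app t u) = app (rename ρ t) (rename ρ u)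

exts : (ℕ → Tm) → ℕ → Tm
exts σ zero    = var zero
exts σ (suc n) = rename suc (σ n)

subst : (ℕ → Tm) → Tm → Tm
subst σ (var x)   = σ x
subst σ (lam t)   = lam (subst (exts σ) t)
subst σ (app t u) = app (subst σ t) (subst σ u)

subst0 : Tm → ℕ → Tm
subst0 v zero    = v
subst0 v (suc n) = var n

-- t{v/x}, where x is the variable bound by the enclosing λ (index 0)
_[_/0] : Tm → Tm → Tm
t [ v /0] = subst (subst0 v) t

data Kind : Set where
  βv σ : Kind

-- root rules; the side conditions x ∉ fv(s), x ∉ fv(v) are the
-- α-conventions, realised by shifting s (resp. v) under the new binder
data Root : Kind → Tm → Tm → Set where
  βv-rule : (t v : Tm) → Value v → Root βv (app (lam t) v) (t [ v /0])
  σ₁-rule : (t u s : Tm) →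
            Root σ (app (app (lam t) u) s) (app (lam (app t (rename suc s))) u)
  σ₃-rule : (v s u : Tm) → Value v →
            Root σ (app v (app (lam s) u)) (app (lam (app (rename suc v) s)) u)

-- closure under balanced contexts B ::= [·] | (λx.B)t | Bt | tB
data Step (k : Kind) : Tm → Tm → Set where
  root : {t u : Tm} → Root k t u → Step k t u
  lamL : {t t' u : Tm} → Step k t t' → Step k (app (lam t) u) (app (lam t') u)
  appL : {t t' u : Tm} → Step k t t' → Step k (app t u) (app t' u)
  appR : {t u u' : Tm} → Step k u u' → Step k (app t u) (app t u')

-- reduction sequences of →sh̄ (each step is a β̄v-step or a σ̄-step)
data _⟶*_ : Tm → Tm → Set where
  ε   : {t : Tm} → t ⟶* t
  _◅_ : {k : Kind} {t u s : Tm} → Step k t u → u ⟶* s → t ⟶* s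

infixr 5 _◅_

lengβv : {t u : Tm} → t ⟶* u → ℕ
lengβv ε                = 0
lengβv (_◅_ {βv} _ d)   = suc (lengβv d)
lengβv (_◅_ {σ}  _ d)   = lengβv d

Normal : Tm → Set
Normal t = (k : Kind) (u : Tm) → ¬ Step k t u

bsize : Tm → ℕ
bsize (var _)                 = 0
bsize (lam _)                 = 0
bsize (app (lam s) u)         = bsize s + bsize u + 1
bsize (app (var x) u)         = bsize (var x) + bsize u + 1
bsize (app (app t₁ t₂) u)     = bsize (app t₁ t₂) + bsize u + 1

-- Types: multisets represented by lists, with multiset equality
-- (deep: permutation up to equality of the elements)

mutual
  data Neg : Set where
    _⊸_ : Pos → Pos → Neg

  Pos : Set
  Pos = List Neg

infixr 6 _⊸_

mutual
  data _≈ᴺ_ : Neg → Neg → Set where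
    ⊸≈ : {P P' Q Q' : Pos} → P ≈ᴾ P' → Q ≈ᴾ Q' → (P ⊸ Q) ≈ᴺ (P' ⊸ Q')

  data _≈ᴾ_ : Pos → Pos → Set where
    []≈   : [] ≈ᴾ []
    ∷≈    : {N N' : Neg} {P P' : Pos} → N ≈ᴺ N' → P ≈ᴾ P' → (N ∷ P) ≈ᴾ (N' ∷ P')
    swap≈ : (N M : Neg) (P : Pos) → (N ∷ M ∷ P) ≈ᴾ (M ∷ N ∷ P)
    trans≈ : {P Q R : Pos} → P ≈ᴾ Q → Q ≈ᴾ R → P ≈ᴾ R

Env : Set
Env = ℕ → Pos

∅ : Env
∅ _ = []

_⊎ᴱ_ : Env → Env → Env
(Γ ⊎ᴱ Δ) x = Γ x ++ Δ x

⟨_∶_⟩ : ℕ → Pos → Env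
⟨ x ∶ P ⟩ y = if y ≡ᵇ x then P else []

-- Γ, x : P  is represented by an Env whose index 0 is P; Γ is its tail
tailᴱ : Env → Env
tailᴱ Γ y = Γ (suc y)

mutual
  data _⊢_∶_ : Env → Tm → Pos → Set where
    ax  : (x : ℕ) (P : Pos) → ⟨ x ∶ P ⟩ ⊢ var x ∶ P
    app : {Γ Γ' : Env} {t u : Tm} {P P' Q : Pos} →
          Γ ⊢ t ∶ ((P ⊸ Q) ∷ []) → Γ' ⊢ u ∶ P' → P ≈ᴾ P' →
          (Γ ⊎ᴱ Γ') ⊢ app t u ∶ Q
    lam : {Γ : Env} {t : Tm} {P : Pos} → LamPrems t Γ P → Γ ⊢ lam t ∶ P

  -- the n ≥ 0 premises Γᵢ, x : Pᵢ ⊢ t : Qᵢ of the (λ) rule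
  data LamPrems (t : Tm) : Env → Pos → Set where
    []  : LamPrems t ∅ []
    _∷_ : {Γ Δ : Env} {Q R : Pos} →
          Γ ⊢ t ∶ Q → LamPrems t Δ R →
          LamPrems t (tailᴱ Γ ⊎ᴱ Δ) ((Γ zero ⊸ Q) ∷ R)

mutual
  size : {Γ : Env} {t : Tm} {P : Pos} → Γ ⊢ t ∶ P → ℕ
  size (ax _ _)      = 0
  size (app π ρ _)   = size π + size ρ + 1
  size (lam ps)      = sizes ps

  sizes : {Γ : Env} {t : Tm} {P : Pos} → LamPrems t Γ P → ℕ
  sizes []       = 0
  sizes (π ∷ ps) = size π + sizes ps

Minimal : {Γ : Env} {t : Tm} {P : Pos} → Γ ⊢ t ∶ P → Set
Minimal {t = t} π = (Γ' : Env) (P' : Pos) (π' : Γ' ⊢ t ∶ P') → size π ≤ size π'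

-- A derivation is measured by its (@) rules, and a β̄v-step uses up exactly one
-- of them while σ̄-steps use none, in both directions: subject reduction along
-- a step of kind k takes a derivation of t to one of u that is smaller by
-- cost k, and subject expansion takes a derivation of u to one of t that is
-- larger by cost k. For βv these are the substitution lemma and its converse,
-- which hold because a derivation of a value splits and merges additively along
-- any decomposition of its multiset type. Comparing minimal derivations at both
-- ends of d in the two directions gives leng_βv(d) + |π₀| = |π|. Finally every
-- derivation of t has at least ‖t‖ (@) rules, and a normal form has one with
-- exactly ‖t₀‖ of them: in a normal form every application other than a redex
-- (λx.s)u is headed by a variable, and so is the argument u of such a redex, so
-- these subterms can be given whatever type is asked of them. Values have
-- ‖v‖ = 0.

module Submission where

open import Defs
open import Algebra.Bundles using (CommutativeMonoid)
import Algebra.Properties.CommutativeSemigroup as CommutativeSemigroupProperties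
import Algebra.Solver.CommutativeMonoid as CommutativeMonoidSolver
open import Data.Bool using (true; false)
open import Data.Empty using (⊥-elim)
open import Data.List using ([]; _∷_; _++_; [_]; length)
open import Data.List.Properties using (++-assoc; ++-identityʳ)
open import Data.List.Relation.Binary.Pointwise as Pointwise using (Pointwise; []; _∷_)
open import Data.Nat using (ℕ; zero; suc; _+_; _≤_; z≤n; _≟_; _≡ᵇ_)
open import Data.Nat.Properties
  using (+-assoc; +-comm; +-identityʳ; +-commutativeSemigroup; suc-injective;
         ≤-antisym; ≤-trans; ≤-reflexive; +-monoʳ-≤; +-monoˡ-≤; +-mono-≤)
open import Data.Nat.Tactic.RingSolver using (solve-∀)
open import Data.Product using (∃-syntax; _×_; _,_; proj₂)
open import Function using (_∘_)
open import Relation.Binary.Definitions using (Reflexive; Symmetric; Transitive)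
open import Relation.Binary.PropositionalEquality
  using (_≡_; _≢_; refl; sym; trans; cong; cong₂)
open import Relation.Nullary using (yes; no)

open Relation.Binary.PropositionalEquality.≡-Reasoning
open CommutativeSemigroupProperties +-commutativeSemigroup using ()
  renaming (interchange to +-interchange; x∙yz≈y∙xz to +-x∙yz≈y∙xz; xy∙z≈xz∙y to +-xy∙z≈xz∙y)

mutual
  ≈ᴺ-refl : Reflexive _≈ᴺ_
  ≈ᴺ-refl {P ⊸ Q} = ⊸≈ ≈ᴾ-refl ≈ᴾ-refl

  ≈ᴾ-refl : Reflexive _≈ᴾ_
  ≈ᴾ-refl {[]}    = []≈
  ≈ᴾ-refl {N ∷ P} = ∷≈ ≈ᴺ-refl ≈ᴾ-refl

mutual
  ≈ᴺ-sym : Symmetric _≈ᴺ_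
  ≈ᴺ-sym (⊸≈ p q) = ⊸≈ (≈ᴾ-sym p) (≈ᴾ-sym q)

  ≈ᴾ-sym : Symmetric _≈ᴾ_
  ≈ᴾ-sym []≈           = []≈
  ≈ᴾ-sym (∷≈ n p)      = ∷≈ (≈ᴺ-sym n) (≈ᴾ-sym p)
  ≈ᴾ-sym (swap≈ N M P) = swap≈ M N P
  ≈ᴾ-sym (trans≈ p q)  = trans≈ (≈ᴾ-sym q) (≈ᴾ-sym p)

≈ᴺ-trans : Transitive _≈ᴺ_
≈ᴺ-trans (⊸≈ p q) (⊸≈ p′ q′) = ⊸≈ (trans≈ p p′) (trans≈ q q′)

≡⇒≈ᴾ : {P Q : Pos} → P ≡ Q → P ≈ᴾ Q
≡⇒≈ᴾ refl = ≈ᴾ-refl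

++-congˡ : (P : Pos) {R R′ : Pos} → R ≈ᴾ R′ → (P ++ R) ≈ᴾ (P ++ R′)
++-congˡ []      r = r
++-congˡ (N ∷ P) r = ∷≈ ≈ᴺ-refl (++-congˡ P r)

++-congʳ : (R : Pos) {P P′ : Pos} → P ≈ᴾ P′ → (P ++ R) ≈ᴾ (P′ ++ R)
++-congʳ R []≈           = ≈ᴾ-refl
++-congʳ R (∷≈ n p)      = ∷≈ n (++-congʳ R p)
++-congʳ R (swap≈ N M P) = swap≈ N M (P ++ R)
++-congʳ R (trans≈ p q)  = trans≈ (++-congʳ R p) (++-congʳ R q)

++-cong : {P P′ R R′ : Pos} → P ≈ᴾ P′ → R ≈ᴾ R′ → (P ++ R) ≈ᴾ (P′ ++ R′)
++-cong {P′ = P′} {R} p r = trans≈ (++-congʳ R p) (++-congˡ P′ r)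

∷-shift : (N : Neg) (P R : Pos) → (N ∷ P ++ R) ≈ᴾ (P ++ N ∷ R)
∷-shift N []      R = ≈ᴾ-refl
∷-shift N (M ∷ P) R = trans≈ (swap≈ N M (P ++ R)) (∷≈ ≈ᴺ-refl (∷-shift N P R))

++-comm : (P R : Pos) → (P ++ R) ≈ᴾ (R ++ P)
++-comm []      R = ≡⇒≈ᴾ (sym (++-identityʳ R))
++-comm (N ∷ P) R = trans≈ (∷≈ ≈ᴺ-refl (++-comm P R)) (∷-shift N R P)

≈ᴾ-length : {P Q : Pos} → P ≈ᴾ Q → length P ≡ length Q
≈ᴾ-length []≈           = refl
≈ᴾ-length (∷≈ _ p)      = cong suc (≈ᴾ-length p)
≈ᴾ-length (swap≈ _ _ _) = refl
≈ᴾ-length (trans≈ p q)  = trans (≈ᴾ-length p) (≈ᴾ-length q)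

≈ᴾ-[] : {P : Pos} → P ≈ᴾ [] → P ≡ []
≈ᴾ-[] {[]}    _ = refl
≈ᴾ-[] {_ ∷ _} p with ≈ᴾ-length p
... | ()

singleton-≈ᴾ : {N : Neg} {Q : Pos} → [ N ] ≈ᴾ Q → ∃[ M ] (Q ≡ [ M ] × N ≈ᴺ M)
singleton-≈ᴾ (∷≈ n p) with ≈ᴾ-[] (≈ᴾ-sym p)
... | refl = _ , refl , n
singleton-≈ᴾ (trans≈ p q) with singleton-≈ᴾ p
... | _ , refl , n with singleton-≈ᴾ q
...   | _ , refl , m = _ , refl , ≈ᴺ-trans n m

_≈ᴱ_ : Env → Env → Set
Γ ≈ᴱ Δ = ∀ x → Γ x ≈ᴾ Δ x

≈ᴱ-refl : Reflexive _≈ᴱ_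
≈ᴱ-refl _ = ≈ᴾ-refl

≈ᴱ-sym : Symmetric _≈ᴱ_
≈ᴱ-sym e x = ≈ᴾ-sym (e x)

≈ᴱ-trans : Transitive _≈ᴱ_
≈ᴱ-trans e f x = trans≈ (e x) (f x)

⊎ᴱ-cong : {Γ Γ′ Δ Δ′ : Env} → Γ ≈ᴱ Γ′ → Δ ≈ᴱ Δ′ → (Γ ⊎ᴱ Δ) ≈ᴱ (Γ′ ⊎ᴱ Δ′)
⊎ᴱ-cong e f x = ++-cong (e x) (f x)

⊎ᴱ-commutativeMonoid : CommutativeMonoid _ _
⊎ᴱ-commutativeMonoid = record
  { Carrier = Env
  ; _≈_ = _≈ᴱ_
  ; _∙_ = _⊎ᴱ_
  ; ε = ∅
  ; isCommutativeMonoid = record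
    { isMonoid = record
      { isSemigroup = record
        { isMagma = record
          { isEquivalence = record { refl = ≈ᴱ-refl ; sym = ≈ᴱ-sym ; trans = ≈ᴱ-trans }
          ; ∙-cong = ⊎ᴱ-cong
          }
        ; assoc = λ Γ Δ Θ x → ≡⇒≈ᴾ (++-assoc (Γ x) (Δ x) (Θ x))
        }
      ; identity = (λ _ _ → ≈ᴾ-refl) , (λ Γ x → ≡⇒≈ᴾ (++-identityʳ (Γ x)))
      }
    ; comm = λ Γ Δ x → ++-comm (Γ x) (Δ x)
    }
  }

open CommutativeMonoid ⊎ᴱ-commutativeMonoid
  using () renaming (assoc to ⊎ᴱ-assoc; identityˡ to ⊎ᴱ-identityˡ; identityʳ to ⊎ᴱ-identityʳ)
open CommutativeSemigroupProperties (CommutativeMonoid.commutativeSemigroup ⊎ᴱ-commutativeMonoid)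
  using () renaming (interchange to ⊎ᴱ-interchange; x∙yz≈y∙xz to ⊎ᴱ-x∙yz≈y∙xz)
open CommutativeMonoidSolver ⊎ᴱ-commutativeMonoid
  using (_⊕_; id; _⊜_) renaming (solve to solveᴱ)

⟨⟩-self : (x : ℕ) (P : Pos) → ⟨ x ∶ P ⟩ x ≡ P
⟨⟩-self zero    P = refl
⟨⟩-self (suc x) P = ⟨⟩-self x P

⟨⟩-other : {x y : ℕ} (P : Pos) → y ≢ x → ⟨ x ∶ P ⟩ y ≡ []
⟨⟩-other {zero}  {zero}  P y≢x = ⊥-elim (y≢x refl)
⟨⟩-other {zero}  {suc y} P _   = refl
⟨⟩-other {suc x} {zero}  P _   = refl
⟨⟩-other {suc x} {suc y} P y≢x = ⟨⟩-other P (y≢x ∘ cong suc)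

⟨⟩-reindex : {ρ : ℕ → ℕ} → (∀ {a b} → ρ a ≡ ρ b → a ≡ b) →
             (x : ℕ) (P : Pos) (y : ℕ) → ⟨ ρ x ∶ P ⟩ (ρ y) ≡ ⟨ x ∶ P ⟩ y
⟨⟩-reindex {ρ} ρ-injective x P y with y ≟ x
... | yes refl = trans (⟨⟩-self (ρ x) P) (sym (⟨⟩-self x P))
... | no y≢x   = trans (⟨⟩-other P (y≢x ∘ ρ-injective)) (sym (⟨⟩-other P y≢x))

⟨⟩-[] : (x : ℕ) → ⟨ x ∶ [] ⟩ ≈ᴱ ∅
⟨⟩-[] x y with y ≡ᵇ x
... | true  = []≈
... | false = []≈

⟨⟩-cong : (x : ℕ) {P Q : Pos} → P ≈ᴾ Q → ⟨ x ∶ P ⟩ ≈ᴱ ⟨ x ∶ Q ⟩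
⟨⟩-cong x p y with y ≡ᵇ x
... | true  = p
... | false = []≈

⟨⟩-++ : (x : ℕ) (P Q : Pos) → (⟨ x ∶ P ⟩ ⊎ᴱ ⟨ x ∶ Q ⟩) ≈ᴱ ⟨ x ∶ P ++ Q ⟩
⟨⟩-++ x P Q y with y ≡ᵇ x
... | true  = ≈ᴾ-refl
... | false = []≈

-- Environments are functions and the (@) rule wants a syntactic singleton as
-- the type of the function, so a transformed derivation only matches the
-- intended environment and type up to ≈.
record Der (Γ : Env) (t : Tm) (P : Pos) (n : ℕ) : Set where
  constructor der
  field
    {Γ′}       : Env
    {P′}       : Pos
    derivation : Γ′ ⊢ t ∶ P′
    env≈       : Γ′ ≈ᴱ Γ
    type≈      : P′ ≈ᴾ P
    size≡      : size derivation ≡ n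

exact : {Γ : Env} {t : Tm} {P : Pos} (π : Γ ⊢ t ∶ P) → Der Γ t P (size π)
exact π = der π ≈ᴱ-refl ≈ᴾ-refl refl

recast : {Γ Γ′ : Env} {t : Tm} {P P′ : Pos} {m n : ℕ} →
         Γ ≈ᴱ Γ′ → P ≈ᴾ P′ → m ≡ n → Der Γ t P m → Der Γ′ t P′ n
recast e f s (der π e′ f′ s′) = der π (≈ᴱ-trans e′ e) (trans≈ f′ f) (trans s′ s)

reenv : {Γ Γ′ : Env} {t : Tm} {P : Pos} {n : ℕ} → Γ ≈ᴱ Γ′ → Der Γ t P n → Der Γ′ t P n
reenv e = recast e ≈ᴾ-refl refl

retype : {Γ : Env} {t : Tm} {P P′ : Pos} {n : ℕ} → P ≈ᴾ P′ → Der Γ t P n → Der Γ t P′ n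
retype f = recast ≈ᴱ-refl f refl

Der-≡ : {Γ : Env} {t t′ : Tm} {P : Pos} {n : ℕ} → t ≡ t′ → Der Γ t P n → Der Γ t′ P n
Der-≡ refl d = d

app-Der : {Γ Γ′ : Env} {t u : Tm} {P P′ Q : Pos} {m n : ℕ} →
          Der Γ t [ P ⊸ Q ] m → Der Γ′ u P′ n → P ≈ᴾ P′ → Der (Γ ⊎ᴱ Γ′) (app t u) Q (m + n + 1)
app-Der (der π e f s) (der ρ e′ f′ s′) P≈P′ with singleton-≈ᴾ (≈ᴾ-sym f)
... | _ , refl , ⊸≈ p q =
  der (app π ρ (trans≈ (≈ᴾ-sym p) (trans≈ P≈P′ (≈ᴾ-sym f′)))) (⊎ᴱ-cong e e′) (≈ᴾ-sym q)
      (cong₂ (λ a b → a + b + 1) s s′)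

_≈ᴸ_ : Pos → Pos → Set
_≈ᴸ_ = Pointwise _≈ᴺ_

≈ᴸ-refl : Reflexive _≈ᴸ_
≈ᴸ-refl = Pointwise.refl ≈ᴺ-refl

≈ᴸ⇒≈ᴾ : {P Q : Pos} → P ≈ᴸ Q → P ≈ᴾ Q
≈ᴸ⇒≈ᴾ []       = []≈
≈ᴸ⇒≈ᴾ (n ∷ ns) = ∷≈ n (≈ᴸ⇒≈ᴾ ns)

record Prems (t : Tm) (Δ : Env) (R : Pos) (n : ℕ) : Set where
  constructor prems
  field
    {Δ′}     : Env
    {R′}     : Pos
    premises : LamPrems t Δ′ R′
    env≈     : Δ′ ≈ᴱ Δ
    types≈   : R′ ≈ᴸ R
    size≡    : sizes premises ≡ n

recastᴾ : {Δ Δ′ : Env} {t : Tm} {R R′ : Pos} {m n : ℕ} →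
          Δ ≈ᴱ Δ′ → R ≈ᴸ R′ → m ≡ n → Prems t Δ R m → Prems t Δ′ R′ n
recastᴾ e q s (prems ps e′ q′ s′) =
  prems ps (≈ᴱ-trans e′ e) (Pointwise.transitive ≈ᴺ-trans q′ q) (trans s′ s)

reenvᴾ : {Δ Δ′ : Env} {t : Tm} {R : Pos} {n : ℕ} → Δ ≈ᴱ Δ′ → Prems t Δ R n → Prems t Δ′ R n
reenvᴾ e = recastᴾ e ≈ᴸ-refl refl

[]ᴾ : {t : Tm} → Prems t ∅ [] 0
[]ᴾ = prems [] ≈ᴱ-refl [] refl

infixr 5 _∷ᴾ_
_∷ᴾ_ : {Γ Δ : Env} {t : Tm} {Q R : Pos} {m n : ℕ} →
       Der Γ t Q m → Prems t Δ R n → Prems t (tailᴱ Γ ⊎ᴱ Δ) ((Γ zero ⊸ Q) ∷ R) (m + n)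
der π e f s ∷ᴾ prems ps e′ q s′ =
  prems (π ∷ ps) (⊎ᴱ-cong (e ∘ suc) e′) (⊸≈ (e zero) f ∷ q) (cong₂ _+_ s s′)

lam-Der : {Δ : Env} {t : Tm} {R : Pos} {n : ℕ} → Prems t Δ R n → Der Δ (lam t) R n
lam-Der (prems ps e q s) = der (lam ps) e (≈ᴸ⇒≈ᴾ q) s

permute : {t : Tm} {Δ : Env} {P R R′ : Pos} (ps : LamPrems t Δ P) →
          P ≈ᴸ R → R ≈ᴾ R′ → Prems t Δ R′ (sizes ps)
permute [] [] []≈ = []ᴾ
permute (π ∷ ps) (a ∷ as) (∷≈ n r) =
  recastᴾ ≈ᴱ-refl (≈ᴺ-trans a n ∷ ≈ᴸ-refl) refl (exact π ∷ᴾ permute ps as r)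
permute (_∷_ {Γ = Γ₁} π₁ (_∷_ {Γ = Γ₂} {Δ = Δ} π₂ ps)) (a ∷ b ∷ as) (swap≈ _ _ _) =
  prems (π₂ ∷ π₁ ∷ ps) (⊎ᴱ-x∙yz≈y∙xz (tailᴱ Γ₂) (tailᴱ Γ₁) Δ) (b ∷ a ∷ as)
        (+-x∙yz≈y∙xz (size π₂) (size π₁) (sizes ps))
permute ps as (trans≈ r r′) with permute ps as r
... | prems ps′ e q s = recastᴾ e ≈ᴸ-refl s (permute ps′ q r′)

appendPrems : {t : Tm} {Δ₁ Δ₂ : Env} {P₁ P₂ : Pos} →
              (ps₁ : LamPrems t Δ₁ P₁) (ps₂ : LamPrems t Δ₂ P₂) →
              Prems t (Δ₁ ⊎ᴱ Δ₂) (P₁ ++ P₂) (sizes ps₁ + sizes ps₂)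
appendPrems []       ps₂ = prems ps₂ ≈ᴱ-refl ≈ᴸ-refl refl
appendPrems (_∷_ {Γ = Γ} {Δ = Δ} π ps₁) ps₂ =
  recastᴾ (≈ᴱ-sym (⊎ᴱ-assoc (tailᴱ Γ) Δ _)) ≈ᴸ-refl (sym (+-assoc (size π) (sizes ps₁) _))
          (exact π ∷ᴾ appendPrems ps₁ ps₂)

record Split (J : Env → Pos → ℕ → Set) (Δ : Env) (R₁ R₂ : Pos) (n : ℕ) : Set where
  constructor split
  field
    {Δ₁ Δ₂} : Env
    {n₁ n₂} : ℕ
    left    : J Δ₁ R₁ n₁
    right   : J Δ₂ R₂ n₂
    env≈    : (Δ₁ ⊎ᴱ Δ₂) ≈ᴱ Δ
    size≡   : n₁ + n₂ ≡ n

splitPrems : {t : Tm} {Δ : Env} {P : Pos} (R₁ R₂ : Pos) (ps : LamPrems t Δ P) →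
             P ≈ᴸ (R₁ ++ R₂) → Split (Prems t) Δ R₁ R₂ (sizes ps)
splitPrems []       R₂ ps q = split []ᴾ (prems ps ≈ᴱ-refl q refl) ≈ᴱ-refl refl
splitPrems (N ∷ R₁) R₂ (_∷_ {Γ = Γ} π ps) (a ∷ q) with splitPrems R₁ R₂ ps q
... | split (prems ps₁ e₁ q₁ s₁) right e s =
  split (prems (π ∷ ps₁) (⊎ᴱ-cong ≈ᴱ-refl e₁) (a ∷ q₁) (cong (size π +_) s₁)) right
        (≈ᴱ-trans (⊎ᴱ-assoc (tailᴱ Γ) _ _) (⊎ᴱ-cong ≈ᴱ-refl e))
        (trans (+-assoc (size π) _ _) (cong (size π +_) s))

-- A value is typed with any multiset by typing it with each element: this is
-- why substituting values, and only values, adds sizes exactly.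
value-split : {w : Tm} {Δ : Env} {R₁ R₂ : Pos} {n : ℕ} →
              Value w → Der Δ w (R₁ ++ R₂) n → Split (λ Δ′ → Der Δ′ w) Δ R₁ R₂ n
value-split {R₁ = R₁} {R₂} (var y) (der (ax _ P) e f s) =
  split (exact (ax y R₁)) (exact (ax y R₂))
        (≈ᴱ-trans (⟨⟩-++ y R₁ R₂) (≈ᴱ-trans (⟨⟩-cong y (≈ᴾ-sym f)) e)) s
value-split {R₁ = R₁} {R₂} (lam t) (der (lam ps) e f s) with permute ps ≈ᴸ-refl f
... | prems ps′ e′ q′ s′ with splitPrems R₁ R₂ ps′ q′
...   | split left right e″ s″ =
  split (lam-Der left) (lam-Der right) (≈ᴱ-trans e″ (≈ᴱ-trans e′ e)) (trans s″ (trans s′ s))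

value-merge : {w : Tm} {Δ₁ Δ₂ : Env} {R₁ R₂ : Pos} {n₁ n₂ : ℕ} → Value w →
              Der Δ₁ w R₁ n₁ → Der Δ₂ w R₂ n₂ → Der (Δ₁ ⊎ᴱ Δ₂) w (R₁ ++ R₂) (n₁ + n₂)
value-merge (var y) (der (ax _ P₁) e₁ f₁ s₁) (der (ax _ P₂) e₂ f₂ s₂) =
  der (ax y (P₁ ++ P₂)) (≈ᴱ-trans (≈ᴱ-sym (⟨⟩-++ y P₁ P₂)) (⊎ᴱ-cong e₁ e₂)) (++-cong f₁ f₂)
      (cong₂ _+_ s₁ s₂)
value-merge (lam t) (der (lam ps₁) e₁ f₁ s₁) (der (lam ps₂) e₂ f₂ s₂) =
  recast (⊎ᴱ-cong e₁ e₂) (++-cong f₁ f₂) (cong₂ _+_ s₁ s₂) (lam-Der (appendPrems ps₁ ps₂))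

value-[] : {w : Tm} → Value w → Der ∅ w [] 0
value-[] (var y) = der (ax y []) (⟨⟩-[] y) []≈ refl
value-[] (lam t) = lam-Der []ᴾ

value-[]⁻¹ : {w : Tm} {Δ : Env} {n : ℕ} → Value w → Der Δ w [] n → Δ ≈ᴱ ∅ × n ≡ 0
value-[]⁻¹ (var y) (der (ax _ P) e f s) with ≈ᴾ-[] f
... | refl = ≈ᴱ-trans (≈ᴱ-sym e) (⟨⟩-[] y) , sym s
value-[]⁻¹ (lam t) (der (lam ps) e f s) with ≈ᴾ-[] f
value-[]⁻¹ (lam t) (der (lam []) e f s) | refl = ≈ᴱ-sym e , sym s

-- Weakening and strengthening

-- The renaming that skips index k, as Data.Fin.punchIn does on Fin.
punchIn : ℕ → ℕ → ℕ
punchIn zero    = suc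
punchIn (suc k) = ext (punchIn k)

punchIn-injective : (k : ℕ) {x y : ℕ} → punchIn k x ≡ punchIn k y → x ≡ y
punchIn-injective zero    refl = refl
punchIn-injective (suc k) {zero}  {zero}  _  = refl
punchIn-injective (suc k) {suc x} {suc y} eq = cong suc (punchIn-injective k (suc-injective eq))

punchIn-≢ : (k x : ℕ) → punchIn k x ≢ k
punchIn-≢ zero    x       ()
punchIn-≢ (suc k) zero    ()
punchIn-≢ (suc k) (suc x) eq = punchIn-≢ k x (suc-injective eq)

data PunchView (k : ℕ) : ℕ → Set where
  at   : PunchView k k
  away : (x : ℕ) → PunchView k (punchIn k x)

punchView : (k x : ℕ) → PunchView k x
punchView zero    zero    = at
punchView zero    (suc x) = away x
punchView (suc k) zero    = away zero
punchView (suc k) (suc x) with punchView k x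
... | at     = at
... | away y = away (suc y)

insertᴱ : ℕ → Env → Env
insertᴱ zero    Γ zero    = []
insertᴱ zero    Γ (suc y) = Γ y
insertᴱ (suc k) Γ zero    = Γ zero
insertᴱ (suc k) Γ (suc y) = insertᴱ k (tailᴱ Γ) y

insertᴱ-at : (k : ℕ) (Γ : Env) → insertᴱ k Γ k ≡ []
insertᴱ-at zero    Γ = refl
insertᴱ-at (suc k) Γ = insertᴱ-at k (tailᴱ Γ)

insertᴱ-punchIn : (k : ℕ) (Γ : Env) (x : ℕ) → insertᴱ k Γ (punchIn k x) ≡ Γ x
insertᴱ-punchIn zero    Γ x       = refl
insertᴱ-punchIn (suc k) Γ zero    = refl
insertᴱ-punchIn (suc k) Γ (suc x) = insertᴱ-punchIn k (tailᴱ Γ) x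

insertᴱ-⟨⟩ : (k x : ℕ) (P : Pos) → insertᴱ k ⟨ x ∶ P ⟩ ≈ᴱ ⟨ punchIn k x ∶ P ⟩
insertᴱ-⟨⟩ k x P y with punchView k y
... | at     = ≡⇒≈ᴾ (trans (insertᴱ-at k _) (sym (⟨⟩-other P (punchIn-≢ k x ∘ sym))))
... | away z = ≡⇒≈ᴾ (trans (insertᴱ-punchIn k _ z) (sym (⟨⟩-reindex (punchIn-injective k) x P z)))

insertᴱ-⊎ : (k : ℕ) (Γ Δ : Env) → insertᴱ k (Γ ⊎ᴱ Δ) ≈ᴱ (insertᴱ k Γ ⊎ᴱ insertᴱ k Δ)
insertᴱ-⊎ zero    Γ Δ zero    = []≈
insertᴱ-⊎ zero    Γ Δ (suc y) = ≈ᴾ-refl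
insertᴱ-⊎ (suc k) Γ Δ zero    = ≈ᴾ-refl
insertᴱ-⊎ (suc k) Γ Δ (suc y) = insertᴱ-⊎ k (tailᴱ Γ) (tailᴱ Δ) y

insertᴱ-cong : (k : ℕ) {Γ Δ : Env} → Γ ≈ᴱ Δ → insertᴱ k Γ ≈ᴱ insertᴱ k Δ
insertᴱ-cong zero    e zero    = []≈
insertᴱ-cong zero    e (suc y) = e y
insertᴱ-cong (suc k) e zero    = e zero
insertᴱ-cong (suc k) e (suc y) = insertᴱ-cong k (e ∘ suc) y

insertᴱ-∅ : (k : ℕ) → insertᴱ k ∅ ≈ᴱ ∅
insertᴱ-∅ zero    zero    = []≈
insertᴱ-∅ zero    (suc y) = []≈
insertᴱ-∅ (suc k) zero    = []≈
insertᴱ-∅ (suc k) (suc y) = insertᴱ-∅ k y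

mutual
  weaken : (k : ℕ) {Γ : Env} {t : Tm} {P : Pos} (π : Γ ⊢ t ∶ P) →
           Der (insertᴱ k Γ) (rename (punchIn k) t) P (size π)
  weaken k (ax x P)    = der (ax (punchIn k x) P) (≈ᴱ-sym (insertᴱ-⟨⟩ k x P)) ≈ᴾ-refl refl
  weaken k (app π ρ e) = reenv (≈ᴱ-sym (insertᴱ-⊎ k _ _)) (app-Der (weaken k π) (weaken k ρ) e)
  weaken k (lam ps)    = lam-Der (weakenPrems k ps)

  weakenPrems : (k : ℕ) {Δ : Env} {t : Tm} {P : Pos} (ps : LamPrems t Δ P) →
                Prems (rename (punchIn (suc k)) t) (insertᴱ k Δ) P (sizes ps)
  weakenPrems k []       = reenvᴾ (≈ᴱ-sym (insertᴱ-∅ k)) []ᴾ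
  weakenPrems k (π ∷ ps) = reenvᴾ (≈ᴱ-sym (insertᴱ-⊎ k _ _)) (weaken (suc k) π ∷ᴾ weakenPrems k ps)

weaken-Der : (k : ℕ) {Γ : Env} {t : Tm} {P : Pos} {n : ℕ} →
             Der Γ t P n → Der (insertᴱ k Γ) (rename (punchIn k) t) P n
weaken-Der k (der π e f s) = recast (insertᴱ-cong k e) f s (weaken k π)

mutual
  strengthen : (k : ℕ) (t : Tm) {Γ : Env} {P : Pos} (π : Γ ⊢ rename (punchIn k) t ∶ P) →
               ∃[ Γ₀ ] (Der Γ₀ t P (size π) × insertᴱ k Γ₀ ≈ᴱ Γ)
  strengthen k (var x) (ax _ P) = ⟨ x ∶ P ⟩ , exact (ax x P) , insertᴱ-⟨⟩ k x P
  strengthen k (app t u) (app π ρ e) with strengthen k t π | strengthen k u ρ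
  ... | Γ₁ , d₁ , h₁ | Γ₂ , d₂ , h₂ =
    (Γ₁ ⊎ᴱ Γ₂) , app-Der d₁ d₂ e , ≈ᴱ-trans (insertᴱ-⊎ k Γ₁ Γ₂) (⊎ᴱ-cong h₁ h₂)
  strengthen k (lam t) (lam ps) with strengthenPrems k t ps
  ... | Δ₀ , p , h = Δ₀ , lam-Der p , h

  strengthenPrems : (k : ℕ) (t : Tm) {Δ : Env} {P : Pos}
                    (ps : LamPrems (rename (punchIn (suc k)) t) Δ P) →
                    ∃[ Δ₀ ] (Prems t Δ₀ P (sizes ps) × insertᴱ k Δ₀ ≈ᴱ Δ)
  strengthenPrems k t []       = ∅ , []ᴾ , insertᴱ-∅ k
  strengthenPrems k t (π ∷ ps) with strengthen (suc k) t π | strengthenPrems k t ps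
  ... | Γ₀ , d , h | Δ₀ , p , h′ =
    (tailᴱ Γ₀ ⊎ᴱ Δ₀) , recastᴾ ≈ᴱ-refl (⊸≈ (h zero) ≈ᴾ-refl ∷ ≈ᴸ-refl) refl (d ∷ᴾ p) ,
    ≈ᴱ-trans (insertᴱ-⊎ k (tailᴱ Γ₀) Δ₀) (⊎ᴱ-cong (h ∘ suc) h′)

strengthen-Der : (k : ℕ) (t : Tm) {Γ : Env} {P : Pos} {n : ℕ} →
                 Der Γ (rename (punchIn k) t) P n → ∃[ Γ₀ ] (Der Γ₀ t P n × insertᴱ k Γ₀ ≈ᴱ Γ)
strengthen-Der k t (der π e f s) with strengthen k t π
... | Γ₀ , d , h = Γ₀ , recast ≈ᴱ-refl f s d , ≈ᴱ-trans h e

-- Substitution and its converse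

removeᴱ : ℕ → Env → Env
removeᴱ k Γ = Γ ∘ punchIn k

removeᴱ-⟨⟩-at : (k : ℕ) (P : Pos) → removeᴱ k ⟨ k ∶ P ⟩ ≈ᴱ ∅
removeᴱ-⟨⟩-at k P y = ≡⇒≈ᴾ (⟨⟩-other P (punchIn-≢ k y))

removeᴱ-⟨⟩-punchIn : (k x : ℕ) (P : Pos) → removeᴱ k ⟨ punchIn k x ∶ P ⟩ ≈ᴱ ⟨ x ∶ P ⟩
removeᴱ-⟨⟩-punchIn k x P y = ≡⇒≈ᴾ (⟨⟩-reindex (punchIn-injective k) x P y)

⟨punchIn⟩-at : (k x : ℕ) (P : Pos) → ⟨ punchIn k x ∶ P ⟩ k ≡ []
⟨punchIn⟩-at k x P = ⟨⟩-other P (punchIn-≢ k x ∘ sym)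

shift : ℕ → Tm → Tm
shift zero    v = v
shift (suc k) v = rename suc (shift k v)

substAt : ℕ → Tm → ℕ → Tm
substAt zero    v = subst0 v
substAt (suc k) v = exts (substAt k v)

substAt-at : (k : ℕ) (v : Tm) → substAt k v k ≡ shift k v
substAt-at zero    v = refl
substAt-at (suc k) v = cong (rename suc) (substAt-at k v)

substAt-punchIn : (k : ℕ) (v : Tm) (x : ℕ) → substAt k v (punchIn k x) ≡ var x
substAt-punchIn zero    v x       = refl
substAt-punchIn (suc k) v zero    = refl
substAt-punchIn (suc k) v (suc x) = cong (rename suc) (substAt-punchIn k v x)

rename-Value : {w : Tm} (ρ : ℕ → ℕ) → Value w → Value (rename ρ w)
rename-Value ρ (var x) = var (ρ x)
rename-Value ρ (lam t) = lam _

shift-Value : (k : ℕ) {v : Tm} → Value v → Value (shift k v)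
shift-Value zero    vv = vv
shift-Value (suc k) vv = rename-Value suc (shift-Value k vv)

+-app-interchange : ∀ a m b n → (a + m) + (b + n) + 1 ≡ (a + b + 1) + (m + n)
+-app-interchange = solve-∀

mutual
  substitution : (k : ℕ) {v : Tm} → Value v → {Γ : Env} {t : Tm} {Q : Pos} (π : Γ ⊢ t ∶ Q) →
                 {Δ : Env} {n : ℕ} → Der Δ (shift k v) (Γ k) n →
                 Der (removeᴱ k Γ ⊎ᴱ Δ) (subst (substAt k v) t) Q (size π + n)
  substitution k {v} vv (ax x Q) δ with punchView k x
  ... | at =
    Der-≡ (sym (substAt-at k v))
          (recast (⊎ᴱ-cong (≈ᴱ-sym (removeᴱ-⟨⟩-at k Q)) ≈ᴱ-refl) (≡⇒≈ᴾ (⟨⟩-self k Q)) refl δ)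
  ... | away y with value-[]⁻¹ (shift-Value k vv) (retype (≡⇒≈ᴾ (⟨punchIn⟩-at k y Q)) δ)
  ...   | Δ≈∅ , refl =
    Der-≡ (sym (substAt-punchIn k v y))
          (reenv (≈ᴱ-sym (≈ᴱ-trans (⊎ᴱ-cong (removeᴱ-⟨⟩-punchIn k y Q) Δ≈∅) (⊎ᴱ-identityʳ _)))
                 (exact (ax y Q)))
  substitution k vv (app {Γ = Γ₁} {Γ' = Γ₂} π ρ e) δ with value-split (shift-Value k vv) δ
  ... | split δ₁ δ₂ e′ s′ =
    recast (≈ᴱ-trans (⊎ᴱ-interchange (removeᴱ k Γ₁) _ (removeᴱ k Γ₂) _) (⊎ᴱ-cong ≈ᴱ-refl e′)) ≈ᴾ-refl
           (trans (+-app-interchange (size π) _ (size ρ) _) (cong (size π + size ρ + 1 +_) s′))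
           (app-Der (substitution k vv π δ₁) (substitution k vv ρ δ₂) e)
  substitution k vv (lam ps) δ = lam-Der (substitutionPrems k vv ps δ)

  substitutionPrems : (k : ℕ) {v : Tm} → Value v → {Γ : Env} {t : Tm} {P : Pos}
                      (ps : LamPrems t Γ P) → {Δ : Env} {n : ℕ} → Der Δ (shift k v) (Γ k) n →
                      Prems (subst (substAt (suc k) v) t) (removeᴱ k Γ ⊎ᴱ Δ) P (sizes ps + n)
  substitutionPrems k vv [] δ with value-[]⁻¹ (shift-Value k vv) δ
  ... | Δ≈∅ , refl = reenvᴾ (≈ᴱ-sym (≈ᴱ-trans (⊎ᴱ-cong ≈ᴱ-refl Δ≈∅) (⊎ᴱ-identityʳ _))) []ᴾ
  substitutionPrems k vv (_∷_ {Γ = Γ₁} {Δ = Δ₁} π ps) δ with value-split (shift-Value k vv) δ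
  ... | split δ₁ δ₂ e′ s′ =
    recastᴾ (≈ᴱ-trans (⊎ᴱ-interchange (removeᴱ k (tailᴱ Γ₁)) _ (removeᴱ k Δ₁) _)
                      (⊎ᴱ-cong ≈ᴱ-refl e′))
            (⊸≈ (≡⇒≈ᴾ (++-identityʳ (Γ₁ zero))) ≈ᴾ-refl ∷ ≈ᴸ-refl)
            (trans (+-interchange (size π) _ (sizes ps) _) (cong (size π + sizes ps +_) s′))
            (substitution (suc k) vv π (weaken-Der 0 δ₁) ∷ᴾ substitutionPrems k vv ps δ₂)

record Decomposition (J : Env → ℕ → Set) (k : ℕ) (v : Tm) (Γ : Env) (n : ℕ) : Set where
  constructor decomposition
  field
    {Γₜ Δ}   : Env
    {m₁ m₂}  : ℕ
    body     : J Γₜ m₁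
    argument : Der Δ (shift k v) (Γₜ k) m₂
    env≈     : (removeᴱ k Γₜ ⊎ᴱ Δ) ≈ᴱ Γ
    size≡    : m₁ + m₂ ≡ n

mutual
  antiSubstitution : (k : ℕ) {v : Tm} → Value v → (t : Tm) {Γ : Env} {Q : Pos}
                     (π : Γ ⊢ subst (substAt k v) t ∶ Q) →
                     Decomposition (λ Γₜ → Der Γₜ t Q) k v Γ (size π)
  antiSubstitution k {v} vv (var x) {Γ} {Q} π with punchView k x
  ... | at =
    decomposition (exact (ax k Q))
                  (retype (≡⇒≈ᴾ (sym (⟨⟩-self k Q))) (Der-≡ (substAt-at k v) (exact π)))
                  (≈ᴱ-trans (⊎ᴱ-cong (removeᴱ-⟨⟩-at k Q) ≈ᴱ-refl) (⊎ᴱ-identityˡ Γ)) refl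
  ... | away y with Der-≡ (substAt-punchIn k v y) (exact π)
  ...   | der (ax _ Q′) e f s =
    decomposition (der (ax (punchIn k y) Q′) ≈ᴱ-refl f refl)
                  (retype (≡⇒≈ᴾ (sym (⟨punchIn⟩-at k y Q′))) (value-[] (shift-Value k vv)))
                  (≈ᴱ-trans (⊎ᴱ-identityʳ _) (≈ᴱ-trans (removeᴱ-⟨⟩-punchIn k y Q′) e)) s
  antiSubstitution k vv (app t u) (app π ρ e)
    with antiSubstitution k vv t π | antiSubstitution k vv u ρ
  ... | decomposition {Γ₁} {Δ₁} {m₁} {n₁} b₁ a₁ e₁ s₁
      | decomposition {Γ₂} {Δ₂} {m₂} {n₂} b₂ a₂ e₂ s₂ =
    decomposition (app-Der b₁ b₂ e) (value-merge (shift-Value k vv) a₁ a₂)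
                  (≈ᴱ-trans (⊎ᴱ-interchange (removeᴱ k Γ₁) (removeᴱ k Γ₂) Δ₁ Δ₂) (⊎ᴱ-cong e₁ e₂))
                  (trans (sym (+-app-interchange m₁ n₁ m₂ n₂)) (cong₂ (λ a b → a + b + 1) s₁ s₂))
  antiSubstitution k vv (lam t) (lam ps) with antiSubstitutionPrems k vv t ps
  ... | decomposition p a e s = decomposition (lam-Der p) a e s

  antiSubstitutionPrems : (k : ℕ) {v : Tm} → Value v → (t : Tm) {Γ : Env} {P : Pos}
                          (ps : LamPrems (subst (substAt (suc k) v) t) Γ P) →
                          Decomposition (λ Γₜ → Prems t Γₜ P) k v Γ (sizes ps)
  antiSubstitutionPrems k vv t [] =
    decomposition []ᴾ (value-[] (shift-Value k vv)) (⊎ᴱ-identityʳ ∅) refl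
  antiSubstitutionPrems k {v} vv t (π ∷ ps)
    with antiSubstitution (suc k) vv t π | antiSubstitutionPrems k vv t ps
  ... | decomposition {Γ₁} {_} {m₁} {n₁} b a e s | decomposition {Γ₂} {Δ₂} {m₂} {n₂} bs as es ss
    with strengthen-Der 0 (shift k v) a
  ...   | Δ₀ , a′ , h =
    decomposition (recastᴾ ≈ᴱ-refl (⊸≈ head≈ ≈ᴾ-refl ∷ ≈ᴸ-refl) refl (b ∷ᴾ bs))
                  (value-merge (shift-Value k vv) a′ as)
                  (≈ᴱ-trans (⊎ᴱ-interchange (removeᴱ k (tailᴱ Γ₁)) (removeᴱ k Γ₂) Δ₀ Δ₂)
                            (⊎ᴱ-cong (≈ᴱ-trans (⊎ᴱ-cong ≈ᴱ-refl (h ∘ suc)) (e ∘ suc)) es))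
                  (trans (+-interchange m₁ m₂ n₁ n₂) (cong₂ _+_ s ss))
    where
      head≈ : Γ₁ zero ≈ᴾ _
      head≈ = trans≈ (≡⇒≈ᴾ (sym (++-identityʳ (Γ₁ zero))))
                     (trans≈ (++-congˡ (Γ₁ zero) (h zero)) (e zero))

-- Quantitative subject reduction and expansion

cost : Kind → ℕ
cost βv = 1
cost σ  = 0

-- Offsets on both sides avoid subtraction and let the context cases serve
-- reduction, Transfer (cost k) 0, and expansion, Transfer 0 (cost k), alike.
Transfer : ℕ → ℕ → Tm → Tm → Set
Transfer m n t u = {Γ : Env} {P : Pos} (π : Γ ⊢ t ∶ P) → ∃[ s ] (Der Γ u P s × s + m ≡ size π + n)

+-transferʳ : {m n : ℕ} (s a c : ℕ) → s + m ≡ a + n → (s + c) + m ≡ (a + c) + n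
+-transferʳ {m} {n} s a c eq = begin
  (s + c) + m  ≡⟨ +-xy∙z≈xz∙y s c m ⟩
  (s + m) + c  ≡⟨ cong (_+ c) eq ⟩
  (a + n) + c  ≡⟨ +-xy∙z≈xz∙y a n c ⟩
  (a + c) + n  ∎

+-transferˡ : {m n : ℕ} (c s a : ℕ) → s + m ≡ a + n → (c + s) + m ≡ (c + a) + n
+-transferˡ {m} {n} c s a eq = begin
  (c + s) + m  ≡⟨ +-assoc c s m ⟩
  c + (s + m)  ≡⟨ cong (c +_) eq ⟩
  c + (a + n)  ≡⟨ +-assoc c a n ⟨
  (c + a) + n  ∎

transfer-lam : {m n : ℕ} {t t′ u : Tm} →
               Transfer m n t t′ → Transfer m n (app (lam t) u) (app (lam t′) u)
transfer-lam T (app (lam (ρ ∷ [])) πu e) with T ρ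
... | s , d , eq =
  s + 0 + size πu + 1 , app-Der (lam-Der (d ∷ᴾ []ᴾ)) (exact πu) e ,
  +-transferʳ (s + 0 + size πu) (size ρ + 0 + size πu) 1
    (+-transferʳ (s + 0) (size ρ + 0) (size πu) (+-transferʳ s (size ρ) 0 eq))

transfer-appˡ : {m n : ℕ} {t t′ u : Tm} → Transfer m n t t′ → Transfer m n (app t u) (app t′ u)
transfer-appˡ T (app π ρ e) with T π
... | s , d , eq =
  s + size ρ + 1 , app-Der d (exact ρ) e ,
  +-transferʳ (s + size ρ) (size π + size ρ) 1 (+-transferʳ s (size π) (size ρ) eq)

transfer-appʳ : {m n : ℕ} {t u u′ : Tm} → Transfer m n u u′ → Transfer m n (app t u) (app t u′)
transfer-appʳ T (app π ρ e) with T ρ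
... | s , d , eq =
  size π + s + 1 , app-Der (exact π) d e ,
  +-transferʳ (size π + s) (size π + size ρ) 1 (+-transferˡ (size π) s (size ρ) eq)

root-reduction : {k : Kind} {t u : Tm} → Root k t u → Transfer (cost k) 0 t u
root-reduction (βv-rule t v vv) (app (lam (_∷_ {Γ = Γρ} ρ [])) δ e) =
  size ρ + size δ ,
  reenv (⊎ᴱ-cong (≈ᴱ-sym (⊎ᴱ-identityʳ (tailᴱ Γρ))) ≈ᴱ-refl)
        (substitution 0 vv ρ (retype (≈ᴾ-sym e) (exact δ))) ,
  size-eq (size ρ) (size δ)
  where
    size-eq : ∀ a b → a + b + 1 ≡ a + 0 + b + 1 + 0
    size-eq = solve-∀
root-reduction (σ₁-rule t u s)
               (app {Γ' = Γs} (app {Γ' = Γu} (lam (_∷_ {Γ = Γρ} ρ [])) πu e₁) πs e₂) =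
  _ ,
  reenv (env-eq (tailᴱ Γρ) Γs Γu)
        (app-Der (lam-Der (app-Der (exact ρ) (weaken 0 πs) e₂ ∷ᴾ []ᴾ)) (exact πu)
                 (trans≈ (≡⇒≈ᴾ (++-identityʳ (Γρ zero))) e₁)) ,
  size-eq (size ρ) (size πu) (size πs)
  where
    env-eq : ∀ A S U → (((A ⊎ᴱ S) ⊎ᴱ ∅) ⊎ᴱ U) ≈ᴱ (((A ⊎ᴱ ∅) ⊎ᴱ U) ⊎ᴱ S)
    env-eq = solveᴱ 3 (λ A S U → ((A ⊕ S) ⊕ id) ⊕ U ⊜ ((A ⊕ id) ⊕ U) ⊕ S) ≈ᴱ-refl
    size-eq : ∀ a b c → a + c + 1 + 0 + b + 1 + 0 ≡ a + 0 + b + 1 + c + 1 + 0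
    size-eq = solve-∀
root-reduction (σ₃-rule v s u vv)
               (app {Γ = Γv} πv (app {Γ' = Γu} (lam (_∷_ {Γ = Γρ} ρ [])) πu e₁) e₂) =
  _ ,
  reenv (env-eq Γv (tailᴱ Γρ) Γu)
        (app-Der (lam-Der (app-Der (weaken 0 πv) (exact ρ) e₂ ∷ᴾ []ᴾ)) (exact πu) e₁) ,
  size-eq (size πv) (size ρ) (size πu)
  where
    env-eq : ∀ V A U → (((V ⊎ᴱ A) ⊎ᴱ ∅) ⊎ᴱ U) ≈ᴱ (V ⊎ᴱ ((A ⊎ᴱ ∅) ⊎ᴱ U))
    env-eq = solveᴱ 3 (λ V A U → ((V ⊕ A) ⊕ id) ⊕ U ⊜ V ⊕ ((A ⊕ id) ⊕ U)) ≈ᴱ-refl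
    size-eq : ∀ a b c → a + b + 1 + 0 + c + 1 + 0 ≡ a + (b + 0 + c + 1) + 1 + 0
    size-eq = solve-∀

root-expansion : {k : Kind} {t u : Tm} → Root k t u → Transfer 0 (cost k) u t
root-expansion (βv-rule t v vv) π with antiSubstitution 0 vv t π
... | decomposition {Γₜ} {Δ} {m₁} {m₂} b a e s =
  _ ,
  reenv (≈ᴱ-trans (⊎ᴱ-cong (⊎ᴱ-identityʳ (tailᴱ Γₜ)) (≈ᴱ-refl {Δ})) e)
        (app-Der (lam-Der (b ∷ᴾ []ᴾ)) a ≈ᴾ-refl) ,
  trans (size-eq m₁ m₂) (cong (_+ 1) s)
  where
    size-eq : ∀ a b → a + 0 + b + 1 + 0 ≡ a + b + 1
    size-eq = solve-∀
root-expansion (σ₁-rule t u s)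
               (app {Γ' = Γu} (lam (_∷_ (app {Γ = Γρ} {Γ' = Γs′} ρ πs′ e₂) [])) πu e₁)
  with strengthen 0 s πs′
... | Γs , ds , h =
  _ ,
  reenv (≈ᴱ-trans (⊎ᴱ-cong ≈ᴱ-refl (h ∘ suc)) (env-eq (tailᴱ Γρ) Γu (tailᴱ Γs′)))
        (app-Der (app-Der (lam-Der (exact ρ ∷ᴾ []ᴾ)) (exact πu) argument≈) ds e₂) ,
  size-eq (size ρ) (size πu) (size πs′)
  where
    argument≈ : Γρ zero ≈ᴾ _
    argument≈ = trans≈ (≡⇒≈ᴾ (sym (++-identityʳ (Γρ zero))))
                       (trans≈ (++-congˡ (Γρ zero) (h zero)) e₁)
    env-eq : ∀ A U S → (((A ⊎ᴱ ∅) ⊎ᴱ U) ⊎ᴱ S) ≈ᴱ (((A ⊎ᴱ S) ⊎ᴱ ∅) ⊎ᴱ U)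
    env-eq = solveᴱ 3 (λ A U S → ((A ⊕ id) ⊕ U) ⊕ S ⊜ ((A ⊕ S) ⊕ id) ⊕ U) ≈ᴱ-refl
    size-eq : ∀ a b c → a + 0 + b + 1 + c + 1 + 0 ≡ a + c + 1 + 0 + b + 1 + 0
    size-eq = solve-∀
root-expansion (σ₃-rule v s u vv)
               (app {Γ' = Γu} (lam (_∷_ (app {Γ = Γv′} {Γ' = Γρ} πv′ ρ e₂) [])) πu e₁)
  with strengthen 0 v πv′
... | Γv , dv , h =
  _ ,
  reenv (≈ᴱ-trans (⊎ᴱ-cong (h ∘ suc) ≈ᴱ-refl) (env-eq (tailᴱ Γv′) (tailᴱ Γρ) Γu))
        (app-Der dv (app-Der (lam-Der (exact ρ ∷ᴾ []ᴾ)) (exact πu) argument≈) e₂) ,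
  size-eq (size πv′) (size ρ) (size πu)
  where
    argument≈ : Γρ zero ≈ᴾ _
    argument≈ = trans≈ (++-congʳ (Γρ zero) (h zero)) e₁
    env-eq : ∀ V A U → (V ⊎ᴱ ((A ⊎ᴱ ∅) ⊎ᴱ U)) ≈ᴱ (((V ⊎ᴱ A) ⊎ᴱ ∅) ⊎ᴱ U)
    env-eq = solveᴱ 3 (λ V A U → V ⊕ ((A ⊕ id) ⊕ U) ⊜ ((V ⊕ A) ⊕ id) ⊕ U) ≈ᴱ-refl
    size-eq : ∀ a b c → a + (b + 0 + c + 1) + 1 + 0 ≡ a + b + 1 + 0 + c + 1 + 0
    size-eq = solve-∀

reduction : {k : Kind} {t u : Tm} → Step k t u → Transfer (cost k) 0 t u
reduction (root r)  = root-reduction r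
reduction (lamL st) = transfer-lam (reduction st)
reduction (appL st) = transfer-appˡ (reduction st)
reduction (appR st) = transfer-appʳ (reduction st)

expansion : {k : Kind} {t u : Tm} → Step k t u → Transfer 0 (cost k) u t
expansion (root r)  = root-expansion r
expansion (lamL st) = transfer-lam (expansion st)
expansion (appL st) = transfer-appˡ (expansion st)
expansion (appR st) = transfer-appʳ (expansion st)

lengβv-◅ : {k : Kind} {t u s : Tm} (st : Step k t u) (d : u ⟶* s) →
           lengβv (st ◅ d) ≡ cost k + lengβv d
lengβv-◅ {βv} _ _ = refl
lengβv-◅ {σ}  _ _ = refl

reduction* : {t u : Tm} (d : t ⟶* u) {Γ : Env} {P : Pos} (π : Γ ⊢ t ∶ P) →
             ∃[ s ] (Der Γ u P s × lengβv d + s ≡ size π)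
reduction* ε π = size π , exact π , refl
reduction* (_◅_ {k} st d) π with reduction st π
... | s₁ , der π₁ e f refl , eq₁ with reduction* d π₁
...   | s₂ , d₂ , eq₂ = s₂ , recast e f refl d₂ , (begin
  lengβv (st ◅ d) + s₂     ≡⟨ cong (_+ s₂) (lengβv-◅ st d) ⟩
  (cost k + lengβv d) + s₂ ≡⟨ +-assoc (cost k) (lengβv d) s₂ ⟩
  cost k + (lengβv d + s₂) ≡⟨ cong (cost k +_) eq₂ ⟩
  cost k + size π₁         ≡⟨ +-comm (cost k) (size π₁) ⟩
  size π₁ + cost k         ≡⟨ trans eq₁ (+-identityʳ (size π)) ⟩
  size π                   ∎)

expansion* : {t u : Tm} (d : t ⟶* u) {Γ : Env} {P : Pos} (π : Γ ⊢ u ∶ P) →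
             Der Γ t P (lengβv d + size π)
expansion* ε π = exact π
expansion* (_◅_ {k} st d) π with expansion* d π
... | der π₁ e f s₁ with expansion st π₁
...   | s₂ , d₂ , eq₂ = recast e f (begin
  s₂                           ≡⟨ +-identityʳ s₂ ⟨
  s₂ + 0                       ≡⟨ eq₂ ⟩
  size π₁ + cost k             ≡⟨ +-comm (size π₁) (cost k) ⟩
  cost k + size π₁             ≡⟨ cong (cost k +_) s₁ ⟩
  cost k + (lengβv d + size π) ≡⟨ +-assoc (cost k) (lengβv d) (size π) ⟨
  (cost k + lengβv d) + size π ≡⟨ cong (_+ size π) (lengβv-◅ st d) ⟨
  lengβv (st ◅ d) + size π     ∎) d₂

minimal-size-along : {t u : Tm} (d : t ⟶* u) →
                     {Γ : Env} {P : Pos} (π : Γ ⊢ t ∶ P) → Minimal π →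
                     {Γ₀ : Env} {P₀ : Pos} (π₀ : Γ₀ ⊢ u ∶ P₀) → Minimal π₀ →
                     lengβv d + size π₀ ≡ size π
minimal-size-along d π m π₀ m₀ with reduction* d π | expansion* d π₀
... | s , der π′ _ _ s′ , eq | der π″ _ _ s″ =
  ≤-antisym (≤-trans (+-monoʳ-≤ (lengβv d) (≤-trans (m₀ _ _ π′) (≤-reflexive s′))) (≤-reflexive eq))
            (≤-trans (m _ _ π″) (≤-reflexive s″))

-- Normal forms

bsize≤size : {Γ : Env} {t : Tm} {P : Pos} (π : Γ ⊢ t ∶ P) → bsize t ≤ size π
bsize≤size (ax x P) = z≤n
bsize≤size (lam ps) = z≤n
bsize≤size (app {t = lam s} (lam (ρ ∷ [])) π e) =
  +-monoˡ-≤ 1 (+-mono-≤ (≤-trans (bsize≤size ρ) (≤-reflexive (sym (+-identityʳ (size ρ)))))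
                        (bsize≤size π))
bsize≤size (app {t = var x}   ρ π e) = +-monoˡ-≤ 1 (+-mono-≤ z≤n (bsize≤size π))
bsize≤size (app {t = app a b} ρ π e) = +-monoˡ-≤ 1 (+-mono-≤ (bsize≤size ρ) (bsize≤size π))

normal-appˡ : {t u : Tm} → Normal (app t u) → Normal t
normal-appˡ n k _ st = n k _ (appL st)

normal-appʳ : {t u : Tm} → Normal (app t u) → Normal u
normal-appʳ n k _ st = n k _ (appR st)

normal-body : {t u : Tm} → Normal (app (lam t) u) → Normal t
normal-body n k _ st = n k _ (lamL st)

data Inert : Tm → Set where
  var-app : (x : ℕ) (c : Tm) → Inert (app (var x) c)
  app-app : {a b : Tm} → Inert (app a b) → (c : Tm) → Inert (app (app a b) c)

normal-app-inert : (a b c : Tm) → Normal (app (app a b) c) → Inert (app (app a b) c)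
normal-app-inert (var x)     b c n = app-app (var-app x b) c
normal-app-inert (lam r)     b c n = ⊥-elim (n σ _ (root (σ₁-rule r b c)))
normal-app-inert (app a₁ a₂) b c n = app-app (normal-app-inert a₁ a₂ b (normal-appˡ n)) c

normal-argument-inert : (s u : Tm) → Normal (app (lam s) u) → Inert u
normal-argument-inert s (var y)           n = ⊥-elim (n βv _ (root (βv-rule s (var y) (var y))))
normal-argument-inert s (lam r)           n = ⊥-elim (n βv _ (root (βv-rule s (lam r) (lam r))))
normal-argument-inert s (app (var y) c)   n = var-app y c
normal-argument-inert s (app (lam r) c)   n = ⊥-elim (n σ _ (root (σ₃-rule (lam s) r c (lam s))))
normal-argument-inert s (app (app a b) c) n = normal-app-inert a b c (normal-appʳ n)

mutual
  normal-typable : (t : Tm) → Normal t → ∃[ Γ ] ∃[ P ] Der Γ t P (bsize t)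
  normal-typable (var x)           n = _ , _ , exact (ax x [])
  normal-typable (lam t)           n = _ , _ , lam-Der []ᴾ
  normal-typable (app (var x) c)   n = _ , _ , inert-typable _ (var-app x c) n [] .proj₂
  normal-typable (app (app a b) c) n = _ , _ , inert-typable _ (normal-app-inert a b c n) n [] .proj₂
  normal-typable (app (lam s) u)   n with normal-typable s (normal-body n)
  ... | Γₛ , _ , dₛ with inert-typable u (normal-argument-inert s u n) (normal-appʳ n) (Γₛ zero)
  ...   | _ , dᵤ =
    _ , _ , recast ≈ᴱ-refl ≈ᴾ-refl (cong (λ a → a + bsize u + 1) (+-identityʳ (bsize s)))
                   (app-Der (lam-Der (dₛ ∷ᴾ []ᴾ)) dᵤ ≈ᴾ-refl)

  inert-typable : (t : Tm) → Inert t → Normal t → (Q : Pos) → ∃[ Γ ] Der Γ t Q (bsize t)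
  inert-typable (app (var x) c) (var-app x c) n Q =
    let _ , P , d = normal-typable c (normal-appʳ n)
    in _ , app-Der (exact (ax x [ P ⊸ Q ])) d ≈ᴾ-refl
  inert-typable (app (app a b) c) (app-app i c) n Q =
    let _ , P , d = normal-typable c (normal-appʳ n)
    in _ , app-Der (inert-typable (app a b) i (normal-appˡ n) [ P ⊸ Q ] .proj₂) d ≈ᴾ-refl

minimal-size-normal : {t : Tm} → Normal t →
                      {Γ : Env} {P : Pos} (π : Γ ⊢ t ∶ P) → Minimal π → size π ≡ bsize t
minimal-size-normal {t} n π m with normal-typable t n
... | _ , _ , der π′ _ _ s = ≤-antisym (≤-trans (m _ _ π′) (≤-reflexive s)) (bsize≤size π)

bsize-value : {t : Tm} → Value t → bsize t ≡ 0
bsize-value (var x) = refl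
bsize-value (lam t) = refl

proposition5p3 : (t t₀ : Tm) → Normal t₀ → (d : t ⟶* t₀) →
    {Γ : Env} {P : Pos} (π : Γ ⊢ t ∶ P) → Minimal π →
    {Γ₀ : Env} {P₀ : Pos} (π₀ : Γ₀ ⊢ t₀ ∶ P₀) → Minimal π₀ →
    ((lengβv d + bsize t₀ ≡ size π) × (lengβv d + size π₀ ≡ size π))
    × (Value t₀ → lengβv d ≡ size π)
proposition5p3 t t₀ n d π m π₀ m₀ = (via-bsize , along) , via-value
  where
    along : lengβv d + size π₀ ≡ size π
    along = minimal-size-along d π m π₀ m₀

    via-bsize : lengβv d + bsize t₀ ≡ size π
    via-bsize = trans (cong (lengβv d +_) (sym (minimal-size-normal n π₀ m₀))) along

    via-value : Value t₀ → lengβv d ≡ size π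
    via-value v = begin
      lengβv d              ≡⟨ +-identityʳ (lengβv d) ⟨
      lengβv d + 0          ≡⟨ cong (lengβv d +_) (bsize-value v) ⟨
      lengβv d + bsize t₀   ≡⟨ via-bsize ⟩
      size π                ∎
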